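{- Let $f_n(x,z)=zF_n(x;1,z,1,0)$ for $n\ge1$. Then (1) $f_n(x,z)=f_n(z,x)$; (2) $f_n(x,x)=\sum_{k=2}^{2n}H(n,k)x^k$, where $H(n,k)$ is the number of Dyck paths of semilength $n$ for which the sum of the heights of the first peak and the last peak equals $k$.
   Context: An inversion sequence of length $n$ is a sequence $e=(e_0,\dots,e_{n-1})$ of integers with $0\le e_i\le i$; $I_n$ is the set of them. For $e\in I_n$: $\mathrm{inv}(e)=|\{(i,j):i<j,\ e_i>e_j\}|$, $\mathrm{sum}(e)=\sum_i e_i$, $\mathrm{noz}(e)$ = number of zero entries, $\mathrm{tel}(e)=n-(\text{number of distinct entries of }e)$, $\mathrm{uel}(e)=n-\max(e)-1$. $F_n(x;y,z,p,q)=\sum_{e\in I_n}x^{\mathrm{noz}(e)}y^{\mathrm{tel}(e)}z^{\mathrm{uel}(e)}p^{\mathrm{sum}(e)}q^{\mathrm{inv}(e)}$, with $q^0=1$ so that at $q=0$ only $e$ with $\mathrm{inv}(e)=0$ contribute. A Dyck path of semilength $n$ is a lattice path from $(0,0)$ to $(2n,0)$ with steps $(1,1)$ and $(1,-1)$ never going below the $x$-axis; a peak is an up step immediately followed by a down step, and its height is the height of its top point. -}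

module Defs where

open import Data.Nat using (ℕ; zero; suc; _+_; _*_; _∸_; _^_; _<ᵇ_; _≡ᵇ_; _⊔_)
open import Data.Nat.Properties using (_≟_)
open import Data.Nat.ListAction using (sum)
open import Data.Bool using (Bool; true; false; if_then_else_; _∧_)
open import Data.List using (List; []; _∷_; map; concatMap; upTo; length; filterᵇ; deduplicate; _∷ʳ_)

-- invSeqs n enumerates I_n (each element exactly once): all lists of
-- length n with 0 ≤ e_i ≤ i.
invSeqs : ℕ → List (List ℕ)
invSeqs zero    = [] ∷ []
invSeqs (suc n) = concatMap (λ e → map (λ k → e ∷ʳ k) (upTo (suc n))) (invSeqs n)

noz : List ℕ → ℕ
noz e = length (filterᵇ (λ a → a ≡ᵇ 0) e)

maxE : List ℕ → ℕ
maxE []      = 0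
maxE (a ∷ e) = a ⊔ maxE e

tel : List ℕ → ℕ
tel e = length e ∸ length (deduplicate _≟_ e)

uel : List ℕ → ℕ
uel e = length e ∸ maxE e ∸ 1

sumE : List ℕ → ℕ
sumE = sum

inv : List ℕ → ℕ
inv []      = 0
inv (a ∷ e) = length (filterᵇ (λ b → b <ᵇ a) e) + inv e

-- F_n(x;y,z,p,q), evaluated at natural numbers (with 0^0 = 1).
F : ℕ → ℕ → ℕ → ℕ → ℕ → ℕ → ℕ
F n x y z p q =
  sum (map (λ e → x ^ noz e * y ^ tel e * z ^ uel e * p ^ sumE e * q ^ inv e)
           (invSeqs n))

f : ℕ → ℕ → ℕ → ℕ
f n x z = z * F n x 1 z 1 0

-- Dyck paths, represented as lists of steps: true = up (1,1), false = down (1,-1).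

words : ℕ → List (List Bool)
words zero    = [] ∷ []
words (suc m) = concatMap (λ w → (true ∷ w) ∷ (false ∷ w) ∷ []) (words m)

isDyckFrom : ℕ → List Bool → Bool
isDyckFrom zero    []            = true
isDyckFrom (suc h) []            = false
isDyckFrom h       (true ∷ w)    = isDyckFrom (suc h) w
isDyckFrom zero    (false ∷ w)   = false
isDyckFrom (suc h) (false ∷ w)   = isDyckFrom h w

dyckPaths : ℕ → List (List Bool)
dyckPaths n = filterᵇ (isDyckFrom 0) (words (2 * n))

peakHeightsFrom : ℕ → List Bool → List ℕ
peakHeightsFrom h []                 = []
peakHeightsFrom h (true ∷ false ∷ w) = suc h ∷ peakHeightsFrom (suc h) (false ∷ w)
peakHeightsFrom h (true ∷ w)         = peakHeightsFrom (suc h) w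
peakHeightsFrom h (false ∷ w)        = peakHeightsFrom (h ∸ 1) w

firstOr0 : List ℕ → ℕ
firstOr0 []      = 0
firstOr0 (a ∷ _) = a

lastOr0 : List ℕ → ℕ
lastOr0 []          = 0
lastOr0 (a ∷ [])    = a
lastOr0 (_ ∷ b ∷ l) = lastOr0 (b ∷ l)

firstLastPeakSum : List Bool → ℕ
firstLastPeakSum w = firstOr0 (peakHeightsFrom 0 w) + lastOr0 (peakHeightsFrom 0 w)

H : ℕ → ℕ → ℕ
H n k = length (filterᵇ (λ w → firstLastPeakSum w ≡ᵇ k) (dyckPaths n))

sumFromTo : ℕ → ℕ → (ℕ → ℕ) → ℕ
sumFromTo a b g = sum (map (λ i → g (a + i)) (upTo (suc b ∸ a)))

-- At q = 0 only the inversion sequences without inversions, i.e. the weakly increasing ones,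
-- contribute. They encode Dyck paths: e_i is the number of down steps before the (i+1)-st up
-- step. Under this bijection the number of zeros of e is the height of the first peak and
-- n − max e the height of the last peak, so f_n(x, z) = Σ_P x^first(P) z^last(P) over the Dyck
-- paths P of semilength n; (2) is this identity at z = x, grouped by first(P) + last(P). A path
-- with at least two peaks is U^a D W U D^b for a unique nonnegative walk W from height a − 1 to
-- height b − 1; the number of such walks is symmetric in a and b (read W backwards), which
-- gives (1).

module Submission where

open import Defs
open import Data.Bool using (Bool; true; false; T)
open import Data.List using (List; []; _∷_; _++_; _∷ʳ_; map; concatMap; filterᵇ; length; upTo)
open import Data.List.Properties using (map-++; map-∘; map-cong; map-applyUpTo; map-upTo; length-++)
open import Data.Nat using (ℕ; zero; suc; _+_; _*_; _∸_; _^_; _≡ᵇ_; _≤ᵇ_; _<ᵇ_; _⊔_; _≤_; _<_; s≤s)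
open import Data.Nat.ListAction using (sum)
open import Data.Nat.ListAction.Properties using (sum-++)
open import Data.Nat.Properties
open import Algebra.Properties.CommutativeSemigroup +-commutativeSemigroup using (interchange; x∙yz≈y∙xz)
open import Data.Nat.Tactic.RingSolver using (solve-∀)
open import Data.Product using (_×_; _,_)
open import Function using (_∘_; flip)
open import Relation.Binary.PropositionalEquality
  using (_≡_; refl; sym; trans; cong; cong₂; module ≡-Reasoning)

open ≡-Reasoning

variable
  A B : Set

-- Indicators and finite sums

𝟙 : Bool → ℕ
𝟙 true  = 1
𝟙 false = 0

𝟙*-cong : ∀ b {x y} → (T b → x ≡ y) → 𝟙 b * x ≡ 𝟙 b * y
𝟙*-cong true  x≡y = cong (1 *_) (x≡y _)
𝟙*-cong false _   = refl

≡ᵇ-comm : ∀ m n → (m ≡ᵇ n) ≡ (n ≡ᵇ m)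
≡ᵇ-comm zero    zero    = refl
≡ᵇ-comm zero    (suc n) = refl
≡ᵇ-comm (suc m) zero    = refl
≡ᵇ-comm (suc m) (suc n) = ≡ᵇ-comm m n

𝟙-≡ᵇ-transfer : ∀ m n (g : ℕ → ℕ) → 𝟙 (m ≡ᵇ n) * g n ≡ 𝟙 (n ≡ᵇ m) * g m
𝟙-≡ᵇ-transfer m n g =
  trans (𝟙*-cong (m ≡ᵇ n) (cong g ∘ sym ∘ ≡ᵇ⇒≡ m n)) (cong (λ b → 𝟙 b * g m) (≡ᵇ-comm m n))

≤ᵇ-suc : ∀ m n → (suc m ≤ᵇ suc n) ≡ (m ≤ᵇ n)
≤ᵇ-suc zero    n = refl
≤ᵇ-suc (suc m) n = refl

∑ : List A → (A → ℕ) → ℕ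
∑ xs g = sum (map g xs)

∑-cong : ∀ {g h : A → ℕ} → (∀ x → g x ≡ h x) → ∀ xs → ∑ xs g ≡ ∑ xs h
∑-cong g≗h xs = cong sum (map-cong g≗h xs)

∑-++ : ∀ (xs ys : List A) (g : A → ℕ) → ∑ (xs ++ ys) g ≡ ∑ xs g + ∑ ys g
∑-++ xs ys g = trans (cong sum (map-++ g xs ys)) (sum-++ (map g xs) (map g ys))

∑-map : ∀ (f : A → B) xs (g : B → ℕ) → ∑ (map f xs) g ≡ ∑ xs (g ∘ f)
∑-map f xs g = cong sum (sym (map-∘ xs))

∑-concatMap : ∀ (f : A → List B) xs (g : B → ℕ) → ∑ (concatMap f xs) g ≡ ∑ xs (λ x → ∑ (f x) g)
∑-concatMap f []       g = refl
∑-concatMap f (x ∷ xs) g =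
  trans (∑-++ (f x) (concatMap f xs) g) (cong (∑ (f x) g +_) (∑-concatMap f xs g))

∑-+ : ∀ (xs : List A) (g h : A → ℕ) → ∑ xs (λ x → g x + h x) ≡ ∑ xs g + ∑ xs h
∑-+ []       g h = refl
∑-+ (x ∷ xs) g h = trans (cong (g x + h x +_) (∑-+ xs g h)) (interchange (g x) (h x) _ _)

∑-*ˡ : ∀ (xs : List A) c (g : A → ℕ) → ∑ xs (λ x → c * g x) ≡ c * ∑ xs g
∑-*ˡ []       c g = sym (*-zeroʳ c)
∑-*ˡ (x ∷ xs) c g = trans (cong (c * g x +_) (∑-*ˡ xs c g)) (sym (*-distribˡ-+ c (g x) _))

∑-*ʳ : ∀ (xs : List A) c (g : A → ℕ) → ∑ xs g * c ≡ ∑ xs (λ x → g x * c)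
∑-*ʳ []       c g = refl
∑-*ʳ (x ∷ xs) c g = trans (*-distribʳ-+ c (g x) _) (cong (g x * c +_) (∑-*ʳ xs c g))

∑-zero : ∀ (xs : List A) → ∑ xs (λ _ → 0) ≡ 0
∑-zero []       = refl
∑-zero (x ∷ xs) = ∑-zero xs

∑-comm : ∀ (xs : List A) (ys : List B) (g : A → B → ℕ) →
  ∑ xs (λ x → ∑ ys (g x)) ≡ ∑ ys (λ y → ∑ xs (λ x → g x y))
∑-comm []       ys g = sym (∑-zero ys)
∑-comm (x ∷ xs) ys g =
  trans (cong (∑ ys (g x) +_) (∑-comm xs ys g)) (sym (∑-+ ys (g x) (λ y → ∑ xs (λ x′ → g x′ y))))

sumFromTo-∑-comm : ∀ a b (xs : List A) (g : ℕ → A → ℕ) (c : ℕ → ℕ) →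
  sumFromTo a b (λ k → ∑ xs (g k) * c k) ≡ ∑ xs (λ w → sumFromTo a b (λ k → g k w * c k))
sumFromTo-∑-comm a b xs g c =
  trans (∑-cong (λ i → ∑-*ʳ xs (c (a + i)) (g (a + i))) (upTo (suc b ∸ a)))
        (∑-comm (upTo (suc b ∸ a)) xs (λ i w → g (a + i) w * c (a + i)))

∑-filterᵇ : ∀ (p : A → Bool) xs (g : A → ℕ) → ∑ (filterᵇ p xs) g ≡ ∑ xs (λ x → 𝟙 (p x) * g x)
∑-filterᵇ p []       g = refl
∑-filterᵇ p (x ∷ xs) g with p x
... | true  = cong₂ _+_ (sym (+-identityʳ (g x))) (∑-filterᵇ p xs g)
... | false = ∑-filterᵇ p xs g

length-filterᵇ : ∀ (p : A → Bool) xs → length (filterᵇ p xs) ≡ ∑ xs (𝟙 ∘ p)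
length-filterᵇ p []       = refl
length-filterᵇ p (x ∷ xs) with p x
... | true  = cong suc (length-filterᵇ p xs)
... | false = length-filterᵇ p xs

length-filterᵇ-∷ʳ : ∀ (p : A → Bool) xs x → length (filterᵇ p (xs ∷ʳ x)) ≡ length (filterᵇ p xs) + 𝟙 (p x)
length-filterᵇ-∷ʳ p xs x = begin
  length (filterᵇ p (xs ∷ʳ x))    ≡⟨ length-filterᵇ p (xs ∷ʳ x) ⟩
  ∑ (xs ∷ʳ x) (𝟙 ∘ p)             ≡⟨ ∑-++ xs (x ∷ []) (𝟙 ∘ p) ⟩
  ∑ xs (𝟙 ∘ p) + (𝟙 (p x) + 0)    ≡⟨ cong₂ _+_ (sym (length-filterᵇ p xs)) (+-identityʳ _) ⟩
  length (filterᵇ p xs) + 𝟙 (p x) ∎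

length-∷ʳ : ∀ (xs : List A) x → length (xs ∷ʳ x) ≡ suc (length xs)
length-∷ʳ xs x = trans (length-++ xs) (+-comm (length xs) 1)

∑-upTo-suc : ∀ n (g : ℕ → ℕ) → ∑ (upTo (suc n)) g ≡ g 0 + ∑ (upTo n) (g ∘ suc)
∑-upTo-suc n g =
  cong (λ ys → g 0 + sum ys) (trans (map-applyUpTo suc g n) (sym (map-upTo (g ∘ suc) n)))

∑-upTo-select : ∀ L s (g : ℕ → ℕ) → s < L → ∑ (upTo L) (λ j → 𝟙 (s ≡ᵇ j) * g j) ≡ g s
∑-upTo-select (suc L) zero    g _ = begin
  ∑ (upTo (suc L)) (λ j → 𝟙 (0 ≡ᵇ j) * g j) ≡⟨ ∑-upTo-suc L (λ j → 𝟙 (0 ≡ᵇ j) * g j) ⟩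
  1 * g 0 + ∑ (upTo L) (λ _ → 0)            ≡⟨ cong₂ _+_ (*-identityˡ (g 0)) (∑-zero (upTo L)) ⟩
  g 0 + 0                                   ≡⟨ +-identityʳ (g 0) ⟩
  g 0                                       ∎
∑-upTo-select (suc L) (suc s) g (s≤s s<L) =
  trans (∑-upTo-suc L (λ j → 𝟙 (suc s ≡ᵇ j) * g j)) (∑-upTo-select L s (g ∘ suc) s<L)

antidiagonalSum : ℕ → (ℕ → ℕ → ℕ) → ℕ
antidiagonalSum zero    k = k 0 0
antidiagonalSum (suc T) k = k 0 (suc T) + antidiagonalSum T (λ i j → k (suc i) j)

antidiagonalSum-cong : ∀ T {k k′ : ℕ → ℕ → ℕ} → (∀ i j → i + j ≡ T → k i j ≡ k′ i j) →
  antidiagonalSum T k ≡ antidiagonalSum T k′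
antidiagonalSum-cong zero    eq = eq 0 0 refl
antidiagonalSum-cong (suc T) eq =
  cong₂ _+_ (eq 0 (suc T) refl) (antidiagonalSum-cong T (λ i j i+j≡T → eq (suc i) j (cong suc i+j≡T)))

antidiagonalSum-+ : ∀ T (k k′ : ℕ → ℕ → ℕ) →
  antidiagonalSum T (λ i j → k i j + k′ i j) ≡ antidiagonalSum T k + antidiagonalSum T k′
antidiagonalSum-+ zero    k k′ = refl
antidiagonalSum-+ (suc T) k k′ =
  trans (cong (k 0 (suc T) + k′ 0 (suc T) +_)
              (antidiagonalSum-+ T (λ i j → k (suc i) j) (λ i j → k′ (suc i) j)))
        (interchange (k 0 (suc T)) (k′ 0 (suc T)) _ _)

antidiagonalSum-zero : ∀ T → antidiagonalSum T (λ _ _ → 0) ≡ 0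
antidiagonalSum-zero zero    = refl
antidiagonalSum-zero (suc T) = antidiagonalSum-zero T

antidiagonalSum-peelʳ : ∀ T (k : ℕ → ℕ → ℕ) →
  antidiagonalSum (suc T) k ≡ k (suc T) 0 + antidiagonalSum T (λ i j → k i (suc j))
antidiagonalSum-peelʳ zero    k = +-comm (k 0 1) (k 1 0)
antidiagonalSum-peelʳ (suc T) k =
  trans (cong (k 0 (suc (suc T)) +_) (antidiagonalSum-peelʳ T (λ i j → k (suc i) j)))
        (x∙yz≈y∙xz (k 0 (suc (suc T))) (k (suc (suc T)) 0) _)

antidiagonalSum-diagonal : ∀ N (g : ℕ → ℕ) → antidiagonalSum (N + N) (λ i j → 𝟙 (j ≡ᵇ i) * g i) ≡ g N
antidiagonalSum-diagonal zero    g = +-identityʳ (g 0)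
antidiagonalSum-diagonal (suc N) g = begin
  antidiagonalSum (suc N + suc N) k
    ≡⟨ cong (λ T → antidiagonalSum (suc T) k) (+-suc N N) ⟩
  antidiagonalSum (suc (suc (N + N))) k
    ≡⟨ antidiagonalSum-peelʳ (suc (N + N)) k ⟩
  antidiagonalSum (N + N) (λ i j → 𝟙 (j ≡ᵇ i) * g (suc i))
    ≡⟨ antidiagonalSum-diagonal N (g ∘ suc) ⟩
  g (suc N)
    ∎
  where
  k : ℕ → ℕ → ℕ
  k i j = 𝟙 (j ≡ᵇ i) * g i

∑-upTo-antidiagonal : ∀ T (g : ℕ → ℕ) → ∑ (upTo (suc T)) g ≡ antidiagonalSum T (λ i _ → g i)
∑-upTo-antidiagonal zero    g = +-identityʳ (g 0)
∑-upTo-antidiagonal (suc T) g =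
  trans (∑-upTo-suc (suc T) g) (cong (g 0 +_) (∑-upTo-antidiagonal T (g ∘ suc)))

∑-upTo-window : ∀ m h (F : ℕ → ℕ) →
  ∑ (upTo (suc (m + h))) (λ k → 𝟙 (m ≤ᵇ k) * F k) ≡ antidiagonalSum h (λ d _ → F (m + d))
∑-upTo-window zero    h F = trans (∑-cong (λ k → *-identityˡ (F k)) (upTo (suc h))) (∑-upTo-antidiagonal h F)
∑-upTo-window (suc m) h F = begin
  ∑ (upTo (suc (suc m + h))) (λ k → 𝟙 (suc m ≤ᵇ k) * F k)
    ≡⟨ ∑-upTo-suc (suc (m + h)) (λ k → 𝟙 (suc m ≤ᵇ k) * F k) ⟩
  ∑ (upTo (suc (m + h))) (λ k → 𝟙 (suc m ≤ᵇ suc k) * F (suc k))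
    ≡⟨ ∑-cong (λ k → cong (λ b → 𝟙 b * F (suc k)) (≤ᵇ-suc m k)) (upTo (suc (m + h))) ⟩
  ∑ (upTo (suc (m + h))) (λ k → 𝟙 (m ≤ᵇ k) * F (suc k))
    ≡⟨ ∑-upTo-window m h (F ∘ suc) ⟩
  antidiagonalSum h (λ d _ → F (suc m + d))
    ∎

stepDown : (ℕ → ℕ) → ℕ → ℕ
stepDown g zero    = 0
stepDown g (suc h) = g h

stepDown-cong : ∀ {g g′ : ℕ → ℕ} → (∀ h → g h ≡ g′ h) → ∀ h → stepDown g h ≡ stepDown g′ h
stepDown-cong eq zero    = refl
stepDown-cong eq (suc h) = eq h

stepDown-+ : ∀ (g g′ : ℕ → ℕ) h → stepDown (λ x → g x + g′ x) h ≡ stepDown g h + stepDown g′ h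
stepDown-+ g g′ zero    = refl
stepDown-+ g g′ (suc h) = refl

stepDown-comm : ∀ (g : ℕ → ℕ → ℕ) p q →
  stepDown (λ p′ → stepDown (g p′) q) p ≡ stepDown (λ q′ → stepDown (λ p′ → g p′ q′) p) q
stepDown-comm g zero    zero    = refl
stepDown-comm g zero    (suc q) = refl
stepDown-comm g (suc p) zero    = refl
stepDown-comm g (suc p) (suc q) = refl

antidiagonalSum₃ : ℕ → (ℕ → ℕ → ℕ → ℕ) → ℕ
antidiagonalSum₃ T g = antidiagonalSum T (λ i e → antidiagonalSum e (g i))

antidiagonalSum₃-cong : ∀ T {g g′ : ℕ → ℕ → ℕ → ℕ} → (∀ i c d → i + (c + d) ≡ T → g i c d ≡ g′ i c d) →
  antidiagonalSum₃ T g ≡ antidiagonalSum₃ T g′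
antidiagonalSum₃-cong T eq = antidiagonalSum-cong T λ i e i+e≡T →
  antidiagonalSum-cong e λ c d c+d≡e → eq i c d (trans (cong (i +_) c+d≡e) i+e≡T)

antidiagonalSum₃-peel : ∀ T (g : ℕ → ℕ → ℕ → ℕ) →
  antidiagonalSum₃ (suc T) g ≡
  antidiagonalSum (suc T) (λ i d → g i 0 d) + antidiagonalSum₃ T (λ i c d → g i (suc c) d)
antidiagonalSum₃-peel T g = begin
  antidiagonalSum (suc T) (λ i e → antidiagonalSum e (g i))
    ≡⟨ antidiagonalSum-cong (suc T) (λ i e _ → peel i e) ⟩
  antidiagonalSum (suc T) (λ i e → g i 0 e + stepDown (rest i) e)
    ≡⟨ antidiagonalSum-+ (suc T) (λ i e → g i 0 e) (λ i e → stepDown (rest i) e) ⟩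
  antidiagonalSum (suc T) (λ i e → g i 0 e) + antidiagonalSum (suc T) (λ i e → stepDown (rest i) e)
    ≡⟨ cong (antidiagonalSum (suc T) (λ i e → g i 0 e) +_)
            (antidiagonalSum-peelʳ T (λ i e → stepDown (rest i) e)) ⟩
  antidiagonalSum (suc T) (λ i d → g i 0 d) + antidiagonalSum₃ T (λ i c d → g i (suc c) d)
    ∎
  where
  rest : ℕ → ℕ → ℕ
  rest i e = antidiagonalSum e (λ c d → g i (suc c) d)
  peel : ∀ i e → antidiagonalSum e (g i) ≡ g i 0 e + stepDown (rest i) e
  peel i zero    = sym (+-identityʳ _)
  peel i (suc e) = refl

antidiagonalSum₃-swap : ∀ T (g : ℕ → ℕ → ℕ → ℕ) →
  antidiagonalSum₃ T g ≡ antidiagonalSum₃ T (λ i c d → g c i d)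
antidiagonalSum₃-swap zero    g = refl
antidiagonalSum₃-swap (suc T) g = trans (antidiagonalSum₃-peel T g)
  (cong (antidiagonalSum (suc T) (λ i d → g i 0 d) +_)
        (sym (antidiagonalSum₃-swap T (λ i c d → g c (suc i) d))))

-- Nonnegative walks

nonnegWalks : ℕ → ℕ → ℕ → ℕ
nonnegWalks zero    p q = 𝟙 (p ≡ᵇ q)
nonnegWalks (suc L) p q = nonnegWalks L (suc p) q + stepDown (λ p′ → nonnegWalks L p′ q) p

nonnegWalks-last : ∀ L p q → nonnegWalks (suc L) p q ≡ nonnegWalks L p (suc q) + stepDown (nonnegWalks L p) q
nonnegWalks-last zero    zero    zero    = refl
nonnegWalks-last zero    zero    (suc q) = +-comm (𝟙 (0 ≡ᵇ q)) 0
nonnegWalks-last zero    (suc p) zero    = +-comm 0 (𝟙 (p ≡ᵇ 0))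
nonnegWalks-last zero    (suc p) (suc q) = +-comm (𝟙 (suc p ≡ᵇ q)) (𝟙 (p ≡ᵇ suc q))
nonnegWalks-last (suc L) p q = begin
  W (suc L) (suc p) q + stepDown (λ p′ → W (suc L) p′ q) p
    ≡⟨ cong₂ _+_ (nonnegWalks-last L (suc p) q) (stepDown-cong (λ p′ → nonnegWalks-last L p′ q) p) ⟩
  (a + b) + stepDown (λ p′ → W L p′ (suc q) + stepDown (W L p′) q) p
    ≡⟨ cong ((a + b) +_) (stepDown-+ (λ p′ → W L p′ (suc q)) (λ p′ → stepDown (W L p′) q) p) ⟩
  (a + b) + (c + stepDown (λ p′ → stepDown (W L p′) q) p)
    ≡⟨ cong (λ s → (a + b) + (c + s)) (stepDown-comm (W L) p q) ⟩
  (a + b) + (c + d)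
    ≡⟨ interchange a b c d ⟩
  (a + c) + (b + d)
    ≡⟨ cong ((a + c) +_) (sym (stepDown-+ (W L (suc p)) (λ q′ → stepDown (λ p′ → W L p′ q′) p) q)) ⟩
  W (suc L) p (suc q) + stepDown (W (suc L) p) q
    ∎
  where
  W = nonnegWalks
  a = W L (suc p) (suc q)
  b = stepDown (W L (suc p)) q
  c = stepDown (λ p′ → W L p′ (suc q)) p
  d = stepDown (λ q′ → stepDown (λ p′ → W L p′ q′) p) q

nonnegWalks-sym : ∀ L p q → nonnegWalks L p q ≡ nonnegWalks L q p
nonnegWalks-sym zero    p q = cong 𝟙 (≡ᵇ-comm p q)
nonnegWalks-sym (suc L) p q = begin
  nonnegWalks L (suc p) q + stepDown (λ p′ → nonnegWalks L p′ q) p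
    ≡⟨ cong₂ _+_ (nonnegWalks-sym L (suc p) q) (stepDown-cong (λ p′ → nonnegWalks-sym L p′ q) p) ⟩
  nonnegWalks L q (suc p) + stepDown (nonnegWalks L q) p
    ≡⟨ sym (nonnegWalks-last L q p) ⟩
  nonnegWalks (suc L) q p
    ∎

-- Dyck paths weighted by the heights of their first and last peaks

words-suc : ∀ m (g : List Bool → ℕ) →
  ∑ (words (suc m)) g ≡ ∑ (words m) (λ w → g (true ∷ w)) + ∑ (words m) (λ w → g (false ∷ w))
words-suc m g = begin
  ∑ (words (suc m)) g
    ≡⟨ ∑-concatMap (λ w → (true ∷ w) ∷ (false ∷ w) ∷ []) (words m) g ⟩
  ∑ (words m) (λ w → g (true ∷ w) + (g (false ∷ w) + 0))
    ≡⟨ ∑-cong (λ w → cong (g (true ∷ w) +_) (+-identityʳ _)) (words m) ⟩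
  ∑ (words m) (λ w → g (true ∷ w) + g (false ∷ w))
    ≡⟨ ∑-+ (words m) (λ w → g (true ∷ w)) (λ w → g (false ∷ w)) ⟩
  ∑ (words m) (λ w → g (true ∷ w)) + ∑ (words m) (λ w → g (false ∷ w))
    ∎

isDyckFrom-up : ∀ h w → isDyckFrom h (true ∷ w) ≡ isDyckFrom (suc h) w
isDyckFrom-up zero    w = refl
isDyckFrom-up (suc h) w = refl

lastOr : ℕ → List ℕ → ℕ
lastOr d []      = d
lastOr d (a ∷ l) = lastOr a l

lastOr0-∷ : ∀ a l → lastOr0 (a ∷ l) ≡ lastOr a l
lastOr0-∷ a []      = refl
lastOr0-∷ a (b ∷ l) = lastOr0-∷ b l

lastPeak-up : ∀ h ℓ w → T (isDyckFrom (suc h) w) →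
  lastOr ℓ (peakHeightsFrom h (true ∷ w)) ≡ lastOr (suc h) (peakHeightsFrom (suc h) w)
lastPeak-up h ℓ []          ()
lastPeak-up h ℓ (true ∷ w)  dyck =
  trans (lastPeak-up (suc h) ℓ w dyck) (sym (lastPeak-up (suc h) (suc h) w dyck))
lastPeak-up h ℓ (false ∷ w) dyck = refl

-- m steps remain at height h, past the first peak; ℓ is the height reached by the latest up step,
-- since the last peak of a Dyck path is the top of its last up step.
tailSum : (ℕ → ℕ) → ℕ → ℕ → ℕ → ℕ
tailSum ψ zero    zero    ℓ = ψ ℓ
tailSum ψ zero    (suc h) ℓ = 0
tailSum ψ (suc m) h       ℓ = tailSum ψ m (suc h) (suc h) + stepDown (λ h′ → tailSum ψ m h′ ℓ) h

firstPeakSum : (ℕ → ℕ → ℕ) → ℕ → ℕ → ℕ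
firstPeakSum φ m = stepDown (λ a → tailSum (φ (suc a)) m a (suc a))

-- m steps remain after an initial run of h ≥ 1 up steps.
climbSum : (ℕ → ℕ → ℕ) → ℕ → ℕ → ℕ
climbSum φ zero    h = 0
climbSum φ (suc m) h = climbSum φ m (suc h) + firstPeakSum φ m h

tailSum-words : ∀ ψ m h ℓ →
  tailSum ψ m h ℓ ≡ ∑ (words m) (λ w → 𝟙 (isDyckFrom h w) * ψ (lastOr ℓ (peakHeightsFrom h w)))
tailSum-words ψ zero    zero    ℓ = sym (trans (+-identityʳ _) (*-identityˡ (ψ ℓ)))
tailSum-words ψ zero    (suc h) ℓ = refl
tailSum-words ψ (suc m) h       ℓ = begin
  tailSum ψ m (suc h) (suc h) + stepDown (λ h′ → tailSum ψ m h′ ℓ) h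
    ≡⟨ cong₂ _+_ (tailSum-words ψ m (suc h) (suc h)) (stepDown-cong (λ h′ → tailSum-words ψ m h′ ℓ) h) ⟩
  ∑ (words m) (weight (suc h) (suc h)) + stepDown (λ h′ → ∑ (words m) (weight h′ ℓ)) h
    ≡⟨ cong₂ _+_ (∑-cong (λ w → sym (up w)) (words m)) (down h) ⟩
  ∑ (words m) (λ w → weight h ℓ (true ∷ w)) + ∑ (words m) (λ w → weight h ℓ (false ∷ w))
    ≡⟨ sym (words-suc m (weight h ℓ)) ⟩
  ∑ (words (suc m)) (weight h ℓ)
    ∎
  where
  weight : ℕ → ℕ → List Bool → ℕ
  weight h₀ ℓ₀ w = 𝟙 (isDyckFrom h₀ w) * ψ (lastOr ℓ₀ (peakHeightsFrom h₀ w))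
  up : ∀ w → weight h ℓ (true ∷ w) ≡ weight (suc h) (suc h) w
  up w = trans (cong (λ b → 𝟙 b * ψ (lastOr ℓ (peakHeightsFrom h (true ∷ w)))) (isDyckFrom-up h w))
               (𝟙*-cong (isDyckFrom (suc h) w) (cong ψ ∘ lastPeak-up h ℓ w))
  down : ∀ h → stepDown (λ h′ → ∑ (words m) (weight h′ ℓ)) h ≡ ∑ (words m) (λ w → weight h ℓ (false ∷ w))
  down zero    = sym (∑-zero (words m))
  down (suc h) = refl

climbSum-words : ∀ φ m h → climbSum φ m (suc h) ≡
  ∑ (words m) (λ w → 𝟙 (isDyckFrom (suc h) w) *
                     φ (firstOr0 (peakHeightsFrom h (true ∷ w))) (lastOr0 (peakHeightsFrom h (true ∷ w))))
climbSum-words φ zero    h = refl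
climbSum-words φ (suc m) h = begin
  climbSum φ m (suc (suc h)) + tailSum (φ (suc h)) m h (suc h)
    ≡⟨ cong₂ _+_ (climbSum-words φ m (suc h)) (tailSum-words (φ (suc h)) m h (suc h)) ⟩
  ∑ (words m) (λ w → weight (true ∷ w)) +
  ∑ (words m) (λ w → 𝟙 (isDyckFrom h w) * φ (suc h) (lastOr (suc h) (peakHeightsFrom h w)))
    ≡⟨ cong (∑ (words m) (λ w → weight (true ∷ w)) +_) (∑-cong last (words m)) ⟩
  ∑ (words m) (λ w → weight (true ∷ w)) + ∑ (words m) (λ w → weight (false ∷ w))
    ≡⟨ sym (words-suc m weight) ⟩
  ∑ (words (suc m)) weight
    ∎
  where
  weight : List Bool → ℕ
  weight w = 𝟙 (isDyckFrom (suc h) w) *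
             φ (firstOr0 (peakHeightsFrom h (true ∷ w))) (lastOr0 (peakHeightsFrom h (true ∷ w)))
  last : ∀ w → 𝟙 (isDyckFrom h w) * φ (suc h) (lastOr (suc h) (peakHeightsFrom h w)) ≡ weight (false ∷ w)
  last w = cong (λ l → 𝟙 (isDyckFrom h w) * φ (suc h) l) (sym (lastOr0-∷ (suc h) (peakHeightsFrom h w)))

dyckSum : ℕ → (ℕ → ℕ → ℕ) → ℕ
dyckSum n φ = ∑ (dyckPaths n) (λ w → φ (firstOr0 (peakHeightsFrom 0 w)) (lastOr0 (peakHeightsFrom 0 w)))

n+suc[n+0]≡suc[n+n] : ∀ n → n + suc (n + 0) ≡ suc (n + n)
n+suc[n+0]≡suc[n+n] n = trans (+-suc n (n + 0)) (cong (suc ∘ (n +_)) (+-identityʳ n))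

dyckSum-climbSum : ∀ N φ → dyckSum (suc N) φ ≡ climbSum φ (suc (N + N)) 1
dyckSum-climbSum N φ = begin
  dyckSum (suc N) φ
    ≡⟨ ∑-filterᵇ (isDyckFrom 0) (words (2 * suc N)) _ ⟩
  ∑ (words (suc K)) weight
    ≡⟨ words-suc K weight ⟩
  ∑ (words K) (λ w → weight (true ∷ w)) + ∑ (words K) (λ _ → 0)
    ≡⟨ cong₂ _+_ (sym (climbSum-words φ K 0)) (∑-zero (words K)) ⟩
  climbSum φ K 1 + 0
    ≡⟨ +-identityʳ _ ⟩
  climbSum φ K 1
    ≡⟨ cong (λ m → climbSum φ m 1) (n+suc[n+0]≡suc[n+n] N) ⟩
  climbSum φ (suc (N + N)) 1
    ∎
  where
  K = N + suc (N + 0)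
  weight : List Bool → ℕ
  weight w = 𝟙 (isDyckFrom 0 w) * φ (firstOr0 (peakHeightsFrom 0 w)) (lastOr0 (peakHeightsFrom 0 w))

tailSum-below : ∀ ψ m h ℓ → m < h → tailSum ψ m h ℓ ≡ 0
tailSum-below ψ m       zero    ℓ ()
tailSum-below ψ zero    (suc h) ℓ _         = refl
tailSum-below ψ (suc m) (suc h) ℓ (s≤s m<h) =
  cong₂ _+_ (tailSum-below ψ m (suc (suc h)) (suc (suc h)) (m<n⇒m<1+n (m<n⇒m<1+n m<h)))
            (tailSum-below ψ m h ℓ m<h)

tailSum-descent : ∀ ψ h ℓ → tailSum ψ h h ℓ ≡ ψ ℓ
tailSum-descent ψ zero    ℓ = refl
tailSum-descent ψ (suc h) ℓ =
  cong₂ _+_ (tailSum-below ψ h (suc (suc h)) (suc (suc h)) (m<n⇒m<1+n (n<1+n h))) (tailSum-descent ψ h ℓ)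

-- With r + 1 up steps left, split by the height e + 1 reached by the next up step.
tailSum-nextUp : ∀ ψ r g ℓ → tailSum ψ (suc (suc (g + (r + r)))) g ℓ ≡
  antidiagonalSum g (λ _ e → tailSum ψ (suc e + (r + r)) (suc e) (suc e))
tailSum-nextUp ψ r zero    ℓ = +-identityʳ _
tailSum-nextUp ψ r (suc g) ℓ =
  cong (tailSum ψ (suc (suc g) + (r + r)) (suc (suc g)) (suc (suc g)) +_) (tailSum-nextUp ψ r g ℓ)

climbSum-below : ∀ φ m h → m < h → climbSum φ m h ≡ 0
climbSum-below φ zero    h       _         = refl
climbSum-below φ (suc m) (suc h) (s≤s m<h) =
  cong₂ _+_ (climbSum-below φ m (suc (suc h)) (m<n⇒m<1+n (m<n⇒m<1+n m<h)))
            (tailSum-below (φ (suc h)) m h (suc h) m<h)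

climbSum-summit : ∀ φ h → climbSum φ (suc h) (suc h) ≡ φ (suc h) (suc h)
climbSum-summit φ h =
  cong₂ _+_ (climbSum-below φ h (suc (suc h)) (m<n⇒m<1+n (n<1+n h))) (tailSum-descent (φ (suc h)) h (suc h))

-- A tail containing an up step ends with a walk of length d from h to c, then U, then D^(c+1).
lastUpSum : (ℕ → ℕ) → ℕ → ℕ → ℕ
lastUpSum ψ (suc (suc T)) h = antidiagonalSum T (λ c d → nonnegWalks d h c * ψ (suc c))
lastUpSum ψ _             h = 0

lastUpSum-suc : ∀ ψ m h →
  lastUpSum ψ (suc m) h ≡ 𝟙 (m ≡ᵇ suc h) * ψ (suc h) + lastUpSum ψ m (suc h) + stepDown (lastUpSum ψ m) h
lastUpSum-suc ψ zero          zero    = refl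
lastUpSum-suc ψ zero          (suc h) = refl
lastUpSum-suc ψ (suc zero)    zero    = sym (trans (+-identityʳ (1 * ψ 1 + 0)) (+-identityʳ (1 * ψ 1)))
lastUpSum-suc ψ (suc zero)    (suc h) = refl
lastUpSum-suc ψ (suc (suc T)) h       = begin
  antidiagonalSum (suc T) (λ c d → W d h c * ψ (suc c))
    ≡⟨ antidiagonalSum-peelʳ T (λ c d → W d h c * ψ (suc c)) ⟩
  𝟙 (h ≡ᵇ suc T) * ψ (suc (suc T)) + antidiagonalSum T (λ c d → W (suc d) h c * ψ (suc c))
    ≡⟨ cong₂ _+_ (𝟙-≡ᵇ-transfer h (suc T) (ψ ∘ suc)) split ⟩
  𝟙 (suc T ≡ᵇ h) * ψ (suc h) + (lastUpSum ψ (suc (suc T)) (suc h) + stepDown (lastUpSum ψ (suc (suc T))) h)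
    ≡⟨ sym (+-assoc (𝟙 (suc T ≡ᵇ h) * ψ (suc h)) (lastUpSum ψ (suc (suc T)) (suc h)) _) ⟩
  𝟙 (suc T ≡ᵇ h) * ψ (suc h) + lastUpSum ψ (suc (suc T)) (suc h) + stepDown (lastUpSum ψ (suc (suc T))) h
    ∎
  where
  W = nonnegWalks
  below : ∀ h → antidiagonalSum T (λ c d → stepDown (λ p → W d p c) h * ψ (suc c)) ≡
                stepDown (lastUpSum ψ (suc (suc T))) h
  below zero    = antidiagonalSum-zero T
  below (suc h) = refl
  split : antidiagonalSum T (λ c d → W (suc d) h c * ψ (suc c)) ≡
          lastUpSum ψ (suc (suc T)) (suc h) + stepDown (lastUpSum ψ (suc (suc T))) h
  split = begin
    antidiagonalSum T (λ c d → (W d (suc h) c + stepDown (λ p → W d p c) h) * ψ (suc c))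
      ≡⟨ antidiagonalSum-cong T (λ c d _ → *-distribʳ-+ (ψ (suc c)) (W d (suc h) c) _) ⟩
    antidiagonalSum T (λ c d → W d (suc h) c * ψ (suc c) + stepDown (λ p → W d p c) h * ψ (suc c))
      ≡⟨ antidiagonalSum-+ T (λ c d → W d (suc h) c * ψ (suc c))
                             (λ c d → stepDown (λ p → W d p c) h * ψ (suc c)) ⟩
    lastUpSum ψ (suc (suc T)) (suc h) + antidiagonalSum T (λ c d → stepDown (λ p → W d p c) h * ψ (suc c))
      ≡⟨ cong (lastUpSum ψ (suc (suc T)) (suc h) +_) (below h) ⟩
    lastUpSum ψ (suc (suc T)) (suc h) + stepDown (lastUpSum ψ (suc (suc T))) h
      ∎

tailSum-formula : ∀ ψ m h ℓ → tailSum ψ m h ℓ ≡ 𝟙 (m ≡ᵇ h) * ψ ℓ + lastUpSum ψ m h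
tailSum-formula ψ zero    zero    ℓ = sym (trans (+-identityʳ _) (+-identityʳ (ψ ℓ)))
tailSum-formula ψ zero    (suc h) ℓ = refl
tailSum-formula ψ (suc m) h       ℓ = begin
  tailSum ψ m (suc h) (suc h) + stepDown (λ h′ → tailSum ψ m h′ ℓ) h
    ≡⟨ cong₂ _+_ (tailSum-formula ψ m (suc h) (suc h)) (stepDown-cong (λ h′ → tailSum-formula ψ m h′ ℓ) h) ⟩
  (a + b) + stepDown (λ h′ → 𝟙 (m ≡ᵇ h′) * ψ ℓ + lastUpSum ψ m h′) h
    ≡⟨ cong ((a + b) +_) (stepDown-+ (λ h′ → 𝟙 (m ≡ᵇ h′) * ψ ℓ) (lastUpSum ψ m) h) ⟩
  (a + b) + (stepDown (λ h′ → 𝟙 (m ≡ᵇ h′) * ψ ℓ) h + stepDown (lastUpSum ψ m) h)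
    ≡⟨ cong (λ s → (a + b) + (s + stepDown (lastUpSum ψ m) h)) (descend h) ⟩
  (a + b) + (𝟙 (suc m ≡ᵇ h) * ψ ℓ + stepDown (lastUpSum ψ m) h)
    ≡⟨ x∙yz≈y∙xz (a + b) (𝟙 (suc m ≡ᵇ h) * ψ ℓ) (stepDown (lastUpSum ψ m) h) ⟩
  𝟙 (suc m ≡ᵇ h) * ψ ℓ + (a + b + stepDown (lastUpSum ψ m) h)
    ≡⟨ cong (𝟙 (suc m ≡ᵇ h) * ψ ℓ +_) (sym (lastUpSum-suc ψ m h)) ⟩
  𝟙 (suc m ≡ᵇ h) * ψ ℓ + lastUpSum ψ (suc m) h
    ∎
  where
  a = 𝟙 (m ≡ᵇ suc h) * ψ (suc h)
  b = lastUpSum ψ m (suc h)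
  descend : ∀ h → stepDown (λ h′ → 𝟙 (m ≡ᵇ h′) * ψ ℓ) h ≡ 𝟙 (suc m ≡ᵇ h) * ψ ℓ
  descend zero    = refl
  descend (suc h) = refl

climbSum-unroll : ∀ φ T h → climbSum φ (suc T) h ≡ antidiagonalSum T (λ i j → firstPeakSum φ j (h + i))
climbSum-unroll φ zero    h = cong (firstPeakSum φ 0) (sym (+-identityʳ h))
climbSum-unroll φ (suc T) h = begin
  climbSum φ (suc T) (suc h) + firstPeakSum φ (suc T) h
    ≡⟨ cong (_+ firstPeakSum φ (suc T) h) (climbSum-unroll φ T (suc h)) ⟩
  antidiagonalSum T (λ i j → firstPeakSum φ j (suc h + i)) + firstPeakSum φ (suc T) h
    ≡⟨ +-comm _ (firstPeakSum φ (suc T) h) ⟩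
  firstPeakSum φ (suc T) h + antidiagonalSum T (λ i j → firstPeakSum φ j (suc h + i))
    ≡⟨ cong₂ _+_ (cong (firstPeakSum φ (suc T)) (sym (+-identityʳ h)))
                 (antidiagonalSum-cong T (λ i j _ → cong (firstPeakSum φ j) (sym (+-suc h i)))) ⟩
  firstPeakSum φ (suc T) (h + 0) + antidiagonalSum T (λ i j → firstPeakSum φ j (h + suc i))
    ∎

-- Dyck paths of semilength N + 2 with at least two peaks:
-- U^(i+1) D (walk of length d from i to c) U D^(c+1).
multiPeakSum : (ℕ → ℕ → ℕ) → ℕ → ℕ
multiPeakSum φ zero    = 0
multiPeakSum φ (suc N) = antidiagonalSum₃ (N + N) (λ i c d → nonnegWalks d i c * φ (suc i) (suc c))

multiPeakSum-lastUpSum : ∀ φ N →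
  antidiagonalSum (N + N) (λ i j → lastUpSum (φ (suc i)) j i) ≡ multiPeakSum φ N
multiPeakSum-lastUpSum φ zero    = refl
multiPeakSum-lastUpSum φ (suc N) = begin
  antidiagonalSum (suc N + suc N) k
    ≡⟨ cong (λ T → antidiagonalSum (suc T) k) (+-suc N N) ⟩
  antidiagonalSum (suc (suc (N + N))) k
    ≡⟨ antidiagonalSum-peelʳ (suc (N + N)) k ⟩
  antidiagonalSum (suc (N + N)) (λ i j → k i (suc j))
    ≡⟨ antidiagonalSum-peelʳ (N + N) (λ i j → k i (suc j)) ⟩
  multiPeakSum φ (suc N)
    ∎
  where
  k : ℕ → ℕ → ℕ
  k i j = lastUpSum (φ (suc i)) j i

dyckSum-formula : ∀ N φ → dyckSum (suc N) φ ≡ φ (suc N) (suc N) + multiPeakSum φ N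
dyckSum-formula N φ = begin
  dyckSum (suc N) φ
    ≡⟨ dyckSum-climbSum N φ ⟩
  climbSum φ (suc (N + N)) 1
    ≡⟨ climbSum-unroll φ (N + N) 1 ⟩
  antidiagonalSum (N + N) (λ i j → tailSum (φ (suc i)) j i (suc i))
    ≡⟨ antidiagonalSum-cong (N + N) (λ i j _ → tailSum-formula (φ (suc i)) j i (suc i)) ⟩
  antidiagonalSum (N + N) (λ i j → 𝟙 (j ≡ᵇ i) * φ (suc i) (suc i) + lastUpSum (φ (suc i)) j i)
    ≡⟨ antidiagonalSum-+ (N + N) (λ i j → 𝟙 (j ≡ᵇ i) * φ (suc i) (suc i))
                                 (λ i j → lastUpSum (φ (suc i)) j i) ⟩
  antidiagonalSum (N + N) (λ i j → 𝟙 (j ≡ᵇ i) * φ (suc i) (suc i)) +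
  antidiagonalSum (N + N) (λ i j → lastUpSum (φ (suc i)) j i)
    ≡⟨ cong₂ _+_ (antidiagonalSum-diagonal N (λ i → φ (suc i) (suc i))) (multiPeakSum-lastUpSum φ N) ⟩
  φ (suc N) (suc N) + multiPeakSum φ N
    ∎

multiPeakSum-flip : ∀ φ N → multiPeakSum φ N ≡ multiPeakSum (flip φ) N
multiPeakSum-flip φ zero    = refl
multiPeakSum-flip φ (suc N) = trans (antidiagonalSum₃-swap (N + N) _)
  (antidiagonalSum₃-cong (N + N) (λ i c d _ → cong (_* φ (suc c) (suc i)) (nonnegWalks-sym d c i)))

multiPeakSum-cong : ∀ N {φ ψ : ℕ → ℕ → ℕ} →
  (∀ i c → i + c ≤ N + N → φ (suc i) (suc c) ≡ ψ (suc i) (suc c)) → multiPeakSum φ N ≡ multiPeakSum ψ N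
multiPeakSum-cong zero    eq = refl
multiPeakSum-cong (suc N) eq =
  antidiagonalSum₃-cong (N + N) (λ i c d sum≡ → cong (nonnegWalks d i c *_) (eq i c (bound i c d sum≡)))
  where
  bound : ∀ i c d → i + (c + d) ≡ N + N → i + c ≤ suc N + suc N
  bound i c d sum≡ = ≤-trans (+-monoʳ-≤ i (m≤m+n c d))
    (≤-trans (≤-reflexive sum≡) (+-mono-≤ (n≤1+n N) (n≤1+n N)))

dyckSum-flip : ∀ N φ → dyckSum (suc N) φ ≡ dyckSum (suc N) (flip φ)
dyckSum-flip N φ = begin
  dyckSum (suc N) φ                              ≡⟨ dyckSum-formula N φ ⟩
  φ (suc N) (suc N) + multiPeakSum φ N           ≡⟨ cong (φ (suc N) (suc N) +_) (multiPeakSum-flip φ N) ⟩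
  φ (suc N) (suc N) + multiPeakSum (flip φ) N    ≡⟨ sym (dyckSum-formula N (flip φ)) ⟩
  dyckSum (suc N) (flip φ)                       ∎

dyckSum-cong : ∀ N {φ ψ : ℕ → ℕ → ℕ} →
  (∀ i c → i + c ≤ N + N → φ (suc i) (suc c) ≡ ψ (suc i) (suc c)) → dyckSum (suc N) φ ≡ dyckSum (suc N) ψ
dyckSum-cong N {φ} {ψ} eq = begin
  dyckSum (suc N) φ                     ≡⟨ dyckSum-formula N φ ⟩
  φ (suc N) (suc N) + multiPeakSum φ N  ≡⟨ cong₂ _+_ (eq N N ≤-refl) (multiPeakSum-cong N eq) ⟩
  ψ (suc N) (suc N) + multiPeakSum ψ N  ≡⟨ sym (dyckSum-formula N ψ) ⟩
  dyckSum (suc N) ψ                     ∎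

-- Inversion-free inversion sequences

0^𝟙-<ᵇ : ∀ a k → 0 ^ 𝟙 (k <ᵇ a) ≡ 𝟙 (a ≤ᵇ k)
0^𝟙-<ᵇ zero    k       = refl
0^𝟙-<ᵇ (suc a) zero    = refl
0^𝟙-<ᵇ (suc a) (suc k) = trans (0^𝟙-<ᵇ a k) (cong 𝟙 (sym (≤ᵇ-suc a k)))

𝟙-≤ᵇ-⊔ : ∀ a m k → 𝟙 (a ≤ᵇ k) * 𝟙 (m ≤ᵇ k) ≡ 𝟙 (a ⊔ m ≤ᵇ k)
𝟙-≤ᵇ-⊔ zero    m       k       = +-identityʳ _
𝟙-≤ᵇ-⊔ (suc a) zero    k       = *-identityʳ _
𝟙-≤ᵇ-⊔ (suc a) (suc m) zero    = refl
𝟙-≤ᵇ-⊔ (suc a) (suc m) (suc k) = begin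
  𝟙 (suc a ≤ᵇ suc k) * 𝟙 (suc m ≤ᵇ suc k) ≡⟨ cong₂ (λ b c → 𝟙 b * 𝟙 c) (≤ᵇ-suc a k) (≤ᵇ-suc m k) ⟩
  𝟙 (a ≤ᵇ k) * 𝟙 (m ≤ᵇ k)                 ≡⟨ 𝟙-≤ᵇ-⊔ a m k ⟩
  𝟙 (a ⊔ m ≤ᵇ k)                          ≡⟨ cong 𝟙 (sym (≤ᵇ-suc (a ⊔ m) k)) ⟩
  𝟙 (suc a ⊔ suc m ≤ᵇ suc k)              ∎

∑-invSeqs-suc : ∀ n (g : List ℕ → ℕ) →
  ∑ (invSeqs (suc n)) g ≡ ∑ (invSeqs n) (λ e → ∑ (upTo (suc n)) (λ k → g (e ∷ʳ k)))
∑-invSeqs-suc n g = trans (∑-concatMap (λ e → map (e ∷ʳ_) (upTo (suc n))) (invSeqs n) g)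
                          (∑-cong (λ e → ∑-map (e ∷ʳ_) (upTo (suc n)) g) (invSeqs n))

∑-invSeqs-length : ∀ n (g : ℕ → List ℕ → ℕ) → ∑ (invSeqs n) (λ e → g (length e) e) ≡ ∑ (invSeqs n) (g n)
∑-invSeqs-length zero    g = refl
∑-invSeqs-length (suc n) g = begin
  ∑ (invSeqs (suc n)) (λ e → g (length e) e)
    ≡⟨ ∑-invSeqs-suc n (λ e → g (length e) e) ⟩
  ∑ (invSeqs n) (λ e → ∑ (upTo (suc n)) (λ k → g (length (e ∷ʳ k)) (e ∷ʳ k)))
    ≡⟨ ∑-cong (λ e → ∑-cong (λ k → cong (λ ℓ → g ℓ (e ∷ʳ k)) (length-∷ʳ e k)) (upTo (suc n))) (invSeqs n) ⟩
  ∑ (invSeqs n) (λ e → ∑ (upTo (suc n)) (λ k → g (suc (length e)) (e ∷ʳ k)))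
    ≡⟨ ∑-invSeqs-length n (λ ℓ e → ∑ (upTo (suc n)) (λ k → g (suc ℓ) (e ∷ʳ k))) ⟩
  ∑ (invSeqs n) (λ e → ∑ (upTo (suc n)) (λ k → g (suc n) (e ∷ʳ k)))
    ≡⟨ sym (∑-invSeqs-suc n (g (suc n))) ⟩
  ∑ (invSeqs (suc n)) (g (suc n))
    ∎

noz-∷ʳ : ∀ e k → noz (e ∷ʳ k) ≡ noz e + 𝟙 (k ≡ᵇ 0)
noz-∷ʳ e k = length-filterᵇ-∷ʳ (_≡ᵇ 0) e k

maxE-∷ʳ : ∀ e k → maxE (e ∷ʳ k) ≡ maxE e ⊔ k
maxE-∷ʳ []      k = ⊔-identityʳ k
maxE-∷ʳ (a ∷ e) k = trans (cong (a ⊔_) (maxE-∷ʳ e k)) (sym (⊔-assoc a (maxE e) k))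

inv-∷ʳ : ∀ e k → inv (e ∷ʳ k) ≡ inv e + ∑ e (λ a → 𝟙 (k <ᵇ a))
inv-∷ʳ []      k = refl
inv-∷ʳ (a ∷ e) k = begin
  length (filterᵇ (_<ᵇ a) (e ∷ʳ k)) + inv (e ∷ʳ k)
    ≡⟨ cong₂ _+_ (length-filterᵇ-∷ʳ (_<ᵇ a) e k) (inv-∷ʳ e k) ⟩
  (length (filterᵇ (_<ᵇ a) e) + 𝟙 (k <ᵇ a)) + (inv e + ∑ e (λ b → 𝟙 (k <ᵇ b)))
    ≡⟨ interchange (length (filterᵇ (_<ᵇ a) e)) (𝟙 (k <ᵇ a)) (inv e) _ ⟩
  (length (filterᵇ (_<ᵇ a) e) + inv e) + (𝟙 (k <ᵇ a) + ∑ e (λ b → 𝟙 (k <ᵇ b)))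
    ∎

0^-entries-above : ∀ e k → 0 ^ ∑ e (λ a → 𝟙 (k <ᵇ a)) ≡ 𝟙 (maxE e ≤ᵇ k)
0^-entries-above []      k = refl
0^-entries-above (a ∷ e) k = begin
  0 ^ (𝟙 (k <ᵇ a) + ∑ e (λ b → 𝟙 (k <ᵇ b)))        ≡⟨ ^-distribˡ-+-* 0 (𝟙 (k <ᵇ a)) _ ⟩
  0 ^ 𝟙 (k <ᵇ a) * 0 ^ ∑ e (λ b → 𝟙 (k <ᵇ b))      ≡⟨ cong₂ _*_ (0^𝟙-<ᵇ a k) (0^-entries-above e k) ⟩
  𝟙 (a ≤ᵇ k) * 𝟙 (maxE e ≤ᵇ k)                      ≡⟨ 𝟙-≤ᵇ-⊔ a (maxE e) k ⟩
  𝟙 (a ⊔ maxE e ≤ᵇ k)                               ∎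

0^inv-∷ʳ : ∀ e k → 0 ^ inv (e ∷ʳ k) ≡ 0 ^ inv e * 𝟙 (maxE e ≤ᵇ k)
0^inv-∷ʳ e k = begin
  0 ^ inv (e ∷ʳ k)                                ≡⟨ cong (0 ^_) (inv-∷ʳ e k) ⟩
  0 ^ (inv e + ∑ e (λ a → 𝟙 (k <ᵇ a)))            ≡⟨ ^-distribˡ-+-* 0 (inv e) _ ⟩
  0 ^ inv e * 0 ^ ∑ e (λ a → 𝟙 (k <ᵇ a))          ≡⟨ cong (0 ^ inv e *_) (0^-entries-above e k) ⟩
  0 ^ inv e * 𝟙 (maxE e ≤ᵇ k)                     ∎

inversionFreeSum : ℕ → (ℕ → ℕ → ℕ) → ℕ
inversionFreeSum n G = ∑ (invSeqs n) (λ e → 0 ^ inv e * G (noz e) (maxE e))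

extend : ℕ → (ℕ → ℕ → ℕ) → ℕ → ℕ → ℕ
extend n G a m = ∑ (upTo (suc n)) (λ k → 𝟙 (m ≤ᵇ k) * G (a + 𝟙 (k ≡ᵇ 0)) k)

extendFrom : ℕ → ℕ → (ℕ → ℕ → ℕ) → ℕ → ℕ → ℕ
extendFrom ℓ zero    G = G
extendFrom ℓ (suc r) G = extend ℓ (extendFrom (suc ℓ) r G)

inversionFreeSum-suc : ∀ n G → inversionFreeSum (suc n) G ≡ inversionFreeSum n (extend n G)
inversionFreeSum-suc n G = begin
  ∑ (invSeqs (suc n)) weight
    ≡⟨ ∑-invSeqs-suc n weight ⟩
  ∑ (invSeqs n) (λ e → ∑ (upTo (suc n)) (λ k → weight (e ∷ʳ k)))
    ≡⟨ ∑-cong (λ e → ∑-cong (append e) (upTo (suc n))) (invSeqs n) ⟩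
  ∑ (invSeqs n) (λ e → ∑ (upTo (suc n)) (λ k → 0 ^ inv e * (𝟙 (maxE e ≤ᵇ k) * G (noz e + 𝟙 (k ≡ᵇ 0)) k)))
    ≡⟨ ∑-cong (λ e → ∑-*ˡ (upTo (suc n)) (0 ^ inv e) _) (invSeqs n) ⟩
  inversionFreeSum n (extend n G)
    ∎
  where
  weight : List ℕ → ℕ
  weight e = 0 ^ inv e * G (noz e) (maxE e)
  append : ∀ e k → weight (e ∷ʳ k) ≡ 0 ^ inv e * (𝟙 (maxE e ≤ᵇ k) * G (noz e + 𝟙 (k ≡ᵇ 0)) k)
  append e k = begin
    0 ^ inv (e ∷ʳ k) * G (noz (e ∷ʳ k)) (maxE (e ∷ʳ k))
      ≡⟨ cong₂ _*_ (0^inv-∷ʳ e k) (cong₂ G (noz-∷ʳ e k) (maxE-∷ʳ e k)) ⟩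
    0 ^ inv e * 𝟙 (maxE e ≤ᵇ k) * G (noz e + 𝟙 (k ≡ᵇ 0)) (maxE e ⊔ k)
      ≡⟨ *-assoc (0 ^ inv e) _ _ ⟩
    0 ^ inv e * (𝟙 (maxE e ≤ᵇ k) * G (noz e + 𝟙 (k ≡ᵇ 0)) (maxE e ⊔ k))
      ≡⟨ cong (0 ^ inv e *_) (𝟙*-cong (maxE e ≤ᵇ k) (cong (G _) ∘ m≤n⇒m⊔n≡n ∘ ≤ᵇ⇒≤ (maxE e) k)) ⟩
    0 ^ inv e * (𝟙 (maxE e ≤ᵇ k) * G (noz e + 𝟙 (k ≡ᵇ 0)) k)
      ∎

inversionFreeSum-extendFrom : ∀ ℓ r G → inversionFreeSum (ℓ + r) G ≡ inversionFreeSum ℓ (extendFrom ℓ r G)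
inversionFreeSum-extendFrom ℓ zero    G = cong (λ n → inversionFreeSum n G) (+-identityʳ ℓ)
inversionFreeSum-extendFrom ℓ (suc r) G = begin
  inversionFreeSum (ℓ + suc r) G                         ≡⟨ cong (λ n → inversionFreeSum n G) (+-suc ℓ r) ⟩
  inversionFreeSum (suc ℓ + r) G                         ≡⟨ inversionFreeSum-extendFrom (suc ℓ) r G ⟩
  inversionFreeSum (suc ℓ) (extendFrom (suc ℓ) r G)      ≡⟨ inversionFreeSum-suc ℓ (extendFrom (suc ℓ) r G) ⟩
  inversionFreeSum ℓ (extendFrom ℓ (suc r) G)            ∎

+-double-suc : ∀ m r → m + (suc r + suc r) ≡ suc (suc (m + (r + r)))
+-double-suc = solve-∀

+-suc-split : ∀ m d e → suc (m + d) + suc e ≡ suc (suc m + (d + e))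
+-suc-split = solve-∀

-- Appending k to an inversion-free sequence of length ℓ and maximum m ≤ k appends D^(k − m) U to
-- its path, which then ends at height ℓ + 1 − k.
module _ {n : ℕ} {G φ : ℕ → ℕ → ℕ} (G≡φ : ∀ a m h → m + suc h ≡ n → G a m ≡ φ a (suc h)) where

  extendFrom-tailSum : ∀ r m h a → suc m + suc h + r ≡ n →
    extendFrom (suc m + suc h) r G a (suc m) ≡ tailSum (φ a) (suc h + (r + r)) (suc h) (suc h)
  extendFrom-tailSum zero    m h a eq = begin
    G a (suc m)
      ≡⟨ G≡φ a (suc m) h (trans (sym (+-identityʳ _)) eq) ⟩
    φ a (suc h)
      ≡⟨ sym (tailSum-descent (φ a) (suc h) (suc h)) ⟩
    tailSum (φ a) (suc h) (suc h) (suc h)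
      ≡⟨ cong (λ k → tailSum (φ a) k (suc h) (suc h)) (sym (+-identityʳ (suc h))) ⟩
    tailSum (φ a) (suc h + 0) (suc h) (suc h)
      ∎
  extendFrom-tailSum (suc r) m h a eq = begin
    extend (suc m + suc h) E a (suc m)
      ≡⟨ ∑-upTo-window (suc m) (suc h) (λ k → E (a + 𝟙 (k ≡ᵇ 0)) k) ⟩
    antidiagonalSum (suc h) (λ d _ → E (a + 0) (suc (m + d)))
      ≡⟨ antidiagonalSum-cong (suc h) continue ⟩
    antidiagonalSum (suc h) (λ _ e → tailSum (φ a) (suc e + (r + r)) (suc e) (suc e))
      ≡⟨ sym (tailSum-nextUp (φ a) r (suc h) (suc h)) ⟩
    tailSum (φ a) (suc (suc (suc h + (r + r)))) (suc h) (suc h)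
      ≡⟨ cong (λ k → tailSum (φ a) k (suc h) (suc h)) (sym (+-double-suc (suc h) r)) ⟩
    tailSum (φ a) (suc h + (suc r + suc r)) (suc h) (suc h)
      ∎
    where
    E = extendFrom (suc (suc m + suc h)) r G
    continue : ∀ d e → d + e ≡ suc h →
      E (a + 0) (suc (m + d)) ≡ tailSum (φ a) (suc e + (r + r)) (suc e) (suc e)
    continue d e d+e≡ = begin
      E (a + 0) (suc (m + d))
        ≡⟨ cong₂ (λ ℓ a′ → extendFrom ℓ r G a′ (suc (m + d))) (sym length≡) (+-identityʳ a) ⟩
      extendFrom (suc (m + d) + suc e) r G a (suc (m + d))
        ≡⟨ extendFrom-tailSum r (m + d) e a
             (trans (cong (_+ r) length≡) (trans (sym (+-suc (suc m + suc h) r)) eq)) ⟩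
      tailSum (φ a) (suc e + (r + r)) (suc e) (suc e)
        ∎
      where
      length≡ : suc (m + d) + suc e ≡ suc (suc m + suc h)
      length≡ = trans (+-suc-split m d e) (cong (λ t → suc (suc m + t)) d+e≡)

  extendFrom-climbSum : ∀ r ℓ → suc ℓ + r ≡ n →
    extendFrom (suc ℓ) r G (suc ℓ) 0 ≡ climbSum φ (suc ℓ + (r + r)) (suc ℓ)
  extendFrom-climbSum zero    ℓ eq = begin
    G (suc ℓ) 0                         ≡⟨ G≡φ (suc ℓ) 0 ℓ (trans (sym (+-identityʳ _)) eq) ⟩
    φ (suc ℓ) (suc ℓ)                   ≡⟨ sym (climbSum-summit φ ℓ) ⟩
    climbSum φ (suc ℓ) (suc ℓ)          ≡⟨ cong (λ k → climbSum φ k (suc ℓ)) (sym (+-identityʳ (suc ℓ))) ⟩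
    climbSum φ (suc ℓ + 0) (suc ℓ)      ∎
  extendFrom-climbSum (suc r) ℓ eq = begin
    extend (suc ℓ) E (suc ℓ) 0
      ≡⟨ ∑-upTo-suc (suc ℓ) (λ k → 𝟙 (0 ≤ᵇ k) * E (suc ℓ + 𝟙 (k ≡ᵇ 0)) k) ⟩
    1 * E (suc ℓ + 1) 0 + ∑ (upTo (suc ℓ)) (λ k → 1 * E (suc ℓ + 0) (suc k))
      ≡⟨ cong₂ _+_ (trans (*-identityˡ _) (cong (λ a → E a 0) (+-comm (suc ℓ) 1)))
                   (∑-cong (λ k → trans (*-identityˡ _) (cong (λ a → E a (suc k)) (+-identityʳ (suc ℓ))))
                           (upTo (suc ℓ))) ⟩
    E (suc (suc ℓ)) 0 + ∑ (upTo (suc ℓ)) (λ k → E (suc ℓ) (suc k))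
      ≡⟨ cong (E (suc (suc ℓ)) 0 +_) (∑-upTo-antidiagonal ℓ (λ k → E (suc ℓ) (suc k))) ⟩
    E (suc (suc ℓ)) 0 + antidiagonalSum ℓ (λ d _ → E (suc ℓ) (suc d))
      ≡⟨ cong₂ _+_ (extendFrom-climbSum r (suc ℓ) (trans (sym (+-suc (suc ℓ) r)) eq))
                   (antidiagonalSum-cong ℓ turn) ⟩
    climbSum φ (suc (suc ℓ) + (r + r)) (suc (suc ℓ)) +
    antidiagonalSum ℓ (λ _ e → tailSum (φ (suc ℓ)) (suc e + (r + r)) (suc e) (suc e))
      ≡⟨ cong (climbSum φ (suc (suc ℓ) + (r + r)) (suc (suc ℓ)) +_)
              (sym (tailSum-nextUp (φ (suc ℓ)) r ℓ (suc ℓ))) ⟩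
    climbSum φ (suc (suc (suc (ℓ + (r + r))))) (suc ℓ)
      ≡⟨ cong (λ k → climbSum φ k (suc ℓ)) (sym (+-double-suc (suc ℓ) r)) ⟩
    climbSum φ (suc ℓ + (suc r + suc r)) (suc ℓ)
      ∎
    where
    E = extendFrom (suc (suc ℓ)) r G
    turn : ∀ d e → d + e ≡ ℓ → E (suc ℓ) (suc d) ≡ tailSum (φ (suc ℓ)) (suc e + (r + r)) (suc e) (suc e)
    turn d e d+e≡ℓ = begin
      E (suc ℓ) (suc d)
        ≡⟨ cong (λ k → extendFrom k r G (suc ℓ) (suc d)) (sym length≡) ⟩
      extendFrom (suc d + suc e) r G (suc ℓ) (suc d)
        ≡⟨ extendFrom-tailSum r d e (suc ℓ)
             (trans (cong (_+ r) length≡) (trans (sym (+-suc (suc ℓ) r)) eq)) ⟩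
      tailSum (φ (suc ℓ)) (suc e + (r + r)) (suc e) (suc e)
        ∎
      where
      length≡ : suc d + suc e ≡ suc (suc ℓ)
      length≡ = trans (+-suc-split 0 d e) (cong (suc ∘ suc) d+e≡ℓ)

inversionFreeSum-dyckSum : ∀ N {G φ : ℕ → ℕ → ℕ} → (∀ a m h → m + suc h ≡ suc N → G a m ≡ φ a (suc h)) →
  inversionFreeSum (suc N) G ≡ dyckSum (suc N) φ
inversionFreeSum-dyckSum N {G} {φ} G≡φ = begin
  inversionFreeSum (suc N) G
    ≡⟨ inversionFreeSum-extendFrom 0 (suc N) G ⟩
  inversionFreeSum 0 (extend 0 (extendFrom 1 N G))
    ≡⟨ trans (+-identityʳ _) (*-identityˡ (extend 0 (extendFrom 1 N G) 0 0)) ⟩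
  extend 0 (extendFrom 1 N G) 0 0
    ≡⟨ trans (+-identityʳ _) (*-identityˡ (extendFrom 1 N G 1 0)) ⟩
  extendFrom 1 N G 1 0
    ≡⟨ extendFrom-climbSum G≡φ N 0 refl ⟩
  climbSum φ (suc (N + N)) 1
    ≡⟨ sym (dyckSum-climbSum N φ) ⟩
  dyckSum (suc N) φ
    ∎

f-dyckSum : ∀ N x z → f (suc N) x z ≡ dyckSum (suc N) (λ a b → x ^ a * z ^ b)
f-dyckSum N x z = begin
  z * ∑ (invSeqs (suc N)) weight
    ≡⟨ sym (∑-*ˡ (invSeqs (suc N)) z weight) ⟩
  ∑ (invSeqs (suc N)) (λ e → z * weight e)
    ≡⟨ ∑-cong at-q≡0 (invSeqs (suc N)) ⟩
  ∑ (invSeqs (suc N)) (λ e → 0 ^ inv e * (z * (x ^ noz e * z ^ (length e ∸ maxE e ∸ 1))))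
    ≡⟨ ∑-invSeqs-length (suc N) (λ ℓ e → 0 ^ inv e * (z * (x ^ noz e * z ^ (ℓ ∸ maxE e ∸ 1)))) ⟩
  inversionFreeSum (suc N) (λ a m → z * (x ^ a * z ^ (suc N ∸ m ∸ 1)))
    ≡⟨ inversionFreeSum-dyckSum N {φ = λ a b → x ^ a * z ^ b} last-peak ⟩
  dyckSum (suc N) (λ a b → x ^ a * z ^ b)
    ∎
  where
  weight : List ℕ → ℕ
  weight e = x ^ noz e * 1 ^ tel e * z ^ uel e * 1 ^ sumE e * 0 ^ inv e
  reorder : ∀ z p q r → z * (p * 1 * q * 1 * r) ≡ r * (z * (p * q))
  reorder = solve-∀
  at-q≡0 : ∀ e → z * weight e ≡ 0 ^ inv e * (z * (x ^ noz e * z ^ uel e))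
  at-q≡0 e = trans (cong₂ (λ s t → z * (x ^ noz e * s * z ^ uel e * t * 0 ^ inv e))
                          (^-zeroˡ (tel e)) (^-zeroˡ (sumE e)))
                   (reorder z (x ^ noz e) (z ^ uel e) (0 ^ inv e))
  last-peak : ∀ a m h → m + suc h ≡ suc N → z * (x ^ a * z ^ (suc N ∸ m ∸ 1)) ≡ x ^ a * z ^ suc h
  last-peak a m h eq = begin
    z * (x ^ a * z ^ (suc N ∸ m ∸ 1))   ≡⟨ cong (λ k → z * (x ^ a * z ^ (k ∸ m ∸ 1))) (sym eq) ⟩
    z * (x ^ a * z ^ (m + suc h ∸ m ∸ 1)) ≡⟨ cong (λ k → z * (x ^ a * z ^ (k ∸ 1))) (m+n∸m≡n m (suc h)) ⟩
    z * (x ^ a * z ^ h)                  ≡⟨ *-comm-middle z (x ^ a) (z ^ h) ⟩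
    x ^ a * z ^ suc h                    ∎
    where
    *-comm-middle : ∀ u v w → u * (v * w) ≡ v * (u * w)
    *-comm-middle = solve-∀

f-symmetric : ∀ N x z → f (suc N) x z ≡ f (suc N) z x
f-symmetric N x z = begin
  f (suc N) x z
    ≡⟨ f-dyckSum N x z ⟩
  dyckSum (suc N) (φ x z)
    ≡⟨ dyckSum-flip N (φ x z) ⟩
  dyckSum (suc N) (flip (φ x z))
    ≡⟨ dyckSum-cong N {φ = flip (φ x z)} {ψ = φ z x} (λ i c _ → *-comm (x ^ suc c) (z ^ suc i)) ⟩
  dyckSum (suc N) (φ z x)
    ≡⟨ sym (f-dyckSum N z x) ⟩
  f (suc N) z x
    ∎
  where
  φ : ℕ → ℕ → ℕ → ℕ → ℕ
  φ x z a b = x ^ a * z ^ b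

H-dyckSum : ∀ n k → H n k ≡ dyckSum n (λ a b → 𝟙 (a + b ≡ᵇ k))
H-dyckSum n k = length-filterᵇ (λ w → firstLastPeakSum w ≡ᵇ k) (dyckPaths n)

sumFromTo-select : ∀ N x i c → i + c ≤ N + N →
  sumFromTo 2 (2 * suc N) (λ k → 𝟙 (suc i + suc c ≡ᵇ k) * x ^ k) ≡ x ^ suc i * x ^ suc c
sumFromTo-select N x i c i+c≤ = begin
  ∑ (upTo L) (λ j → 𝟙 (suc i + suc c ≡ᵇ 2 + j) * x ^ (2 + j))
    ≡⟨ ∑-cong (λ j → cong (λ s → 𝟙 (s ≡ᵇ suc j) * x ^ (2 + j)) (+-suc i c)) (upTo L) ⟩
  ∑ (upTo L) (λ j → 𝟙 (i + c ≡ᵇ j) * x ^ (2 + j))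
    ≡⟨ ∑-upTo-select L (i + c) (λ j → x ^ (2 + j))
                     (≤-trans (s≤s i+c≤) (≤-reflexive (sym (n+suc[n+0]≡suc[n+n] N)))) ⟩
  x ^ (2 + (i + c))
    ≡⟨ cong (λ s → x ^ suc s) (sym (+-suc i c)) ⟩
  x ^ (suc i + suc c)
    ≡⟨ ^-distribˡ-+-* x (suc i) (suc c) ⟩
  x ^ suc i * x ^ suc c
    ∎
  where
  L = N + suc (N + 0)

f-diagonal : ∀ N x → f (suc N) x x ≡ sumFromTo 2 (2 * suc N) (λ k → H (suc N) k * x ^ k)
f-diagonal N x = begin
  f (suc N) x x
    ≡⟨ f-dyckSum N x x ⟩
  dyckSum (suc N) (λ a b → x ^ a * x ^ b)
    ≡⟨ dyckSum-cong N {φ = λ a b → x ^ a * x ^ b} {ψ = selected}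
                    (λ i c i+c≤ → sym (sumFromTo-select N x i c i+c≤)) ⟩
  dyckSum (suc N) selected
    ≡⟨ sym (sumFromTo-∑-comm 2 (2 * suc N) (dyckPaths (suc N)) (λ k w → 𝟙 (firstLastPeakSum w ≡ᵇ k)) (x ^_)) ⟩
  sumFromTo 2 (2 * suc N) (λ k → dyckSum (suc N) (λ a b → 𝟙 (a + b ≡ᵇ k)) * x ^ k)
    ≡⟨ ∑-cong (λ j → cong (_* x ^ (2 + j)) (sym (H-dyckSum (suc N) (2 + j)))) (upTo (N + suc (N + 0))) ⟩
  sumFromTo 2 (2 * suc N) (λ k → H (suc N) k * x ^ k)
    ∎
  where
  selected : ℕ → ℕ → ℕ
  selected a b = sumFromTo 2 (2 * suc N) (λ k → 𝟙 (a + b ≡ᵇ k) * x ^ k)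

mainTheorem4 : (n : ℕ) → 1 ≤ n →
    ((x z : ℕ) → f n x z ≡ f n z x) ×
    ((x : ℕ) → f n x x ≡ sumFromTo 2 (2 * n) (λ k → H n k * x ^ k))
mainTheorem4 (suc N) _ = f-symmetric N , f-diagonal N
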